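{- Let $\mathcal{H}$ be a $3$-uniform hypergraph on $n$ vertices such that every vertex of $\mathcal{H}$ lies in at least one and at most two hyperedges of $\mathcal{H}$. Then $\mathcal{H}$ admits a hypergraph matching of size at least $\frac19 n$.
   Context: A hypergraph is $3$-uniform if every hyperedge has exactly $3$ vertices. A hypergraph matching is a collection of pairwise disjoint hyperedges. -}

module Defs where

open import Data.Nat using (ℕ; _≤_; _*_)
open import Data.Fin using (Fin)
open import Data.Fin.Subset using (Subset; ∣_∣; _∈_; _∩_; Empty)
open import Data.List using (List; length; filter)
open import Data.List.Relation.Unary.All using (All)
open import Data.List.Relation.Unary.Unique.Propositional using (Unique)
open import Data.List.Relation.Unary.AllPairs using (AllPairs)
import Data.List.Membership.Propositional as LM
open import Data.Fin.Subset.Properties using (_∈?_)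
open import Data.Product using (_×_; Σ)
open import Relation.Binary.PropositionalEquality using (_≡_)

record Hypergraph (n : ℕ) : Set where
  field
    edges  : List (Subset n)
    unique : Unique edges

open Hypergraph public

ThreeUniform : ∀ {n} → Hypergraph n → Set
ThreeUniform H = All (λ e → ∣ e ∣ ≡ 3) (edges H)

degree : ∀ {n} → Hypergraph n → Fin n → ℕ
degree H v = length (filter (λ e → v ∈? e) (edges H))

IsMatching : ∀ {n} → Hypergraph n → List (Subset n) → Set
IsMatching H M =
  Unique M × All (λ e → e LM.∈ edges H) M × AllPairs (λ e f → Empty (e ∩ f)) M

{-# OPTIONS --safe #-}
module Submission where

-- A greedy, hence maximal, matching M already does the job. Every vertex v
-- lies on an edge f, which meets some e ∈ M in a vertex x; so v lies in the
-- star of x (the union of the at most two edges through x), and thus in the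
-- union N(e) of the stars of the three vertices of e. Each star contains e
-- and has at most 5 vertices, so it adds at most 2 vertices to e, and
-- |N(e)| ≤ 3 + 3·2 = 9. Hence n ≤ Σ_{e ∈ M} |N(e)| ≤ 9 |M|. For r-uniform
-- hypergraphs of maximum degree Δ (r, Δ ≥ 1) the same count gives n ≤ r(1 + (Δ-1)(r-1)) |M|.

open import Defs
open import Data.Nat using (ℕ; zero; suc; _+_; _*_; _≤_)
open import Data.Nat.Properties
  using (≤-reflexive; ≤-trans; +-identityʳ; +-suc; m≤m+n; +-mono-≤; +-monoʳ-≤; +-cancelʳ-≤; *-monoˡ-≤; *-suc; *-comm; module ≤-Reasoning)
open import Data.Nat.Tactic.RingSolver using (solve-∀)
open import Data.Fin using (Fin; zero; suc)
open import Data.Fin.Subset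
  using (Subset; inside; outside; ∣_∣; _∈_; _⊆_; _∩_; _∪_; ⋃; ⊤; ⁅_⁆; Nonempty; Empty)
open import Data.Fin.Subset.Properties
  using (_∈?_; nonempty?; x∈p∩q⁺; x∈p∩q⁻; p⊆p∪q; q⊆p∪q; x∈⁅y⁆⇒x≡y; ∣⁅x⁆∣≡1; p⊆q⇒∣p∣≤∣q∣; ∣⊥∣≡0; ∣⊤∣≡n)
open import Data.Vec using ([]; _∷_; here; there)
open import Data.List using (List; []; _∷_; foldr; map; filter; length)
open import Data.List.Properties using (length-map)
open import Data.List.Relation.Unary.All as All using (All; []; _∷_; all?)
open import Data.List.Relation.Unary.All.Properties as All using (¬All⇒Any¬; all-filter; filter⁺)
open import Data.List.Relation.Unary.Any as Any using (Any; here; there)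
open import Data.List.Relation.Unary.AllPairs using (AllPairs; []; _∷_)
open import Data.List.Relation.Unary.Unique.Propositional using (Unique)
open import Data.List.Membership.Propositional as List using (lose; find)
open import Data.List.Membership.Propositional.Properties using (∈-map⁺; ∈-filter⁺; ∈-filter⁻)
import Data.List.Relation.Binary.Subset.Propositional as List
open import Data.List.Relation.Binary.Subset.Propositional.Properties using (Any-resp-⊆)
open import Data.Product using (Σ; ∃; _×_; _,_; proj₁; proj₂)
import Data.Product as Product
open import Function using (_∘_; id)
open import Relation.Binary using (Decidable)
open import Relation.Nullary using (¬_; yes; no; ¬?)
open import Relation.Nullary.Decidable using (decidable-stable)
open import Relation.Binary.PropositionalEquality using (_≡_; refl; sym; trans; cong; cong₂; subst; module ≡-Reasoning)

private
  variable
    m : ℕ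

∣p∪q∣+∣p∩q∣≡∣p∣+∣q∣ : (p q : Subset m) → ∣ p ∪ q ∣ + ∣ p ∩ q ∣ ≡ ∣ p ∣ + ∣ q ∣
∣p∪q∣+∣p∩q∣≡∣p∣+∣q∣ [] [] = refl
∣p∪q∣+∣p∩q∣≡∣p∣+∣q∣ (inside ∷ p) (inside ∷ q) = cong suc (begin
  ∣ p ∪ q ∣ + suc ∣ p ∩ q ∣  ≡⟨ +-suc ∣ p ∪ q ∣ ∣ p ∩ q ∣ ⟩
  suc (∣ p ∪ q ∣ + ∣ p ∩ q ∣) ≡⟨ cong suc (∣p∪q∣+∣p∩q∣≡∣p∣+∣q∣ p q) ⟩
  suc (∣ p ∣ + ∣ q ∣)         ≡⟨ +-suc ∣ p ∣ ∣ q ∣ ⟨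
  ∣ p ∣ + suc ∣ q ∣           ∎)
  where open ≡-Reasoning
∣p∪q∣+∣p∩q∣≡∣p∣+∣q∣ (inside ∷ p) (outside ∷ q) = cong suc (∣p∪q∣+∣p∩q∣≡∣p∣+∣q∣ p q)
∣p∪q∣+∣p∩q∣≡∣p∣+∣q∣ (outside ∷ p) (inside ∷ q) =
  trans (cong suc (∣p∪q∣+∣p∩q∣≡∣p∣+∣q∣ p q)) (sym (+-suc ∣ p ∣ ∣ q ∣))
∣p∪q∣+∣p∩q∣≡∣p∣+∣q∣ (outside ∷ p) (outside ∷ q) = ∣p∪q∣+∣p∩q∣≡∣p∣+∣q∣ p q

∣p∪q∣≤∣p∣+∣q∣ : (p q : Subset m) → ∣ p ∪ q ∣ ≤ ∣ p ∣ + ∣ q ∣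
∣p∪q∣≤∣p∣+∣q∣ p q = subst (∣ p ∪ q ∣ ≤_) (∣p∪q∣+∣p∩q∣≡∣p∣+∣q∣ p q) (m≤m+n ∣ p ∪ q ∣ ∣ p ∩ q ∣)

∣p∣≡1+k⇒Nonempty : ∀ {k} (p : Subset m) → ∣ p ∣ ≡ suc k → Nonempty p
∣p∣≡1+k⇒Nonempty (inside ∷ p) _ = zero , here
∣p∣≡1+k⇒Nonempty (outside ∷ p) ∣p∣≡1+k = Product.map suc there (∣p∣≡1+k⇒Nonempty p ∣p∣≡1+k)

x∈p⇒⁅x⁆⊆p : ∀ {x : Fin m} {p} → x ∈ p → ⁅ x ⁆ ⊆ p
x∈p⇒⁅x⁆⊆p {x = x} x∈p y∈⁅x⁆ = subst (_∈ _) (sym (x∈⁅y⁆⇒x≡y x y∈⁅x⁆)) x∈p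

_∪⋃_ : Subset m → List (Subset m) → Subset m
p ∪⋃ qs = foldr _∪_ p qs

p⊆p∪⋃qs : (p : Subset m) (qs : List (Subset m)) → p ⊆ p ∪⋃ qs
p⊆p∪⋃qs p [] x∈p = x∈p
p⊆p∪⋃qs p (q ∷ qs) x∈p = q⊆p∪q q (p ∪⋃ qs) (p⊆p∪⋃qs p qs x∈p)

q∈qs⇒q⊆p∪⋃qs : ∀ {p q : Subset m} {qs} → q List.∈ qs → q ⊆ p ∪⋃ qs
q∈qs⇒q⊆p∪⋃qs {qs = _ ∷ qs} (here refl) = p⊆p∪q _
q∈qs⇒q⊆p∪⋃qs {p = p} {qs = q′ ∷ qs} (there q∈qs) = q⊆p∪q q′ (p ∪⋃ qs) ∘ q∈qs⇒q⊆p∪⋃qs q∈qs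

∣p∪⋃qs∣≤∣p∣+∣qs∣*d : ∀ (p : Subset m) d qs → All (λ q → p ⊆ q × ∣ q ∣ ≤ ∣ p ∣ + d) qs →
  ∣ p ∪⋃ qs ∣ ≤ ∣ p ∣ + length qs * d
∣p∪⋃qs∣≤∣p∣+∣qs∣*d p d [] [] = ≤-reflexive (sym (+-identityʳ ∣ p ∣))
∣p∪⋃qs∣≤∣p∣+∣qs∣*d p d (q ∷ qs) ((p⊆q , ∣q∣≤) ∷ bounds) = +-cancelʳ-≤ ∣ p ∣ _ _ (begin
  ∣ q ∪ U ∣ + ∣ p ∣                  ≤⟨ +-monoʳ-≤ ∣ q ∪ U ∣ (p⊆q⇒∣p∣≤∣q∣ p⊆q∩U) ⟩
  ∣ q ∪ U ∣ + ∣ q ∩ U ∣              ≡⟨ ∣p∪q∣+∣p∩q∣≡∣p∣+∣q∣ q U ⟩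
  ∣ q ∣ + ∣ U ∣                      ≤⟨ +-mono-≤ ∣q∣≤ (∣p∪⋃qs∣≤∣p∣+∣qs∣*d p d qs bounds) ⟩
  (∣ p ∣ + d) + (∣ p ∣ + length qs * d) ≡⟨ rearrange ∣ p ∣ d (length qs * d) ⟩
  (∣ p ∣ + (d + length qs * d)) + ∣ p ∣ ∎)
  where
  open ≤-Reasoning
  U = p ∪⋃ qs
  p⊆q∩U : p ⊆ q ∩ U
  p⊆q∩U x∈p = x∈p∩q⁺ (p⊆q x∈p , p⊆p∪⋃qs p qs x∈p)
  rearrange : ∀ a b c → (a + b) + (a + c) ≡ (a + (b + c)) + a
  rearrange = solve-∀

∣⋃qs∣≤∣qs∣*d : ∀ d (qs : List (Subset m)) → All (λ q → ∣ q ∣ ≤ d) qs → ∣ ⋃ qs ∣ ≤ length qs * d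
∣⋃qs∣≤∣qs∣*d {m} d [] [] = ≤-reflexive (∣⊥∣≡0 m)
∣⋃qs∣≤∣qs∣*d d (q ∷ qs) (∣q∣≤d ∷ bounds) =
  ≤-trans (∣p∪q∣≤∣p∣+∣q∣ q (⋃ qs)) (+-mono-≤ ∣q∣≤d (∣⋃qs∣≤∣qs∣*d d qs bounds))

1≤length⇒∃∈ : ∀ {a} {A : Set a} (xs : List A) → 1 ≤ length xs → ∃ (List._∈ xs)
1≤length⇒∃∈ (x ∷ _) _ = x , here refl

elements : Subset m → List (Fin m)
elements [] = []
elements (inside ∷ p) = zero ∷ map suc (elements p)
elements (outside ∷ p) = map suc (elements p)

length-elements : (p : Subset m) → length (elements p) ≡ ∣ p ∣
length-elements [] = refl
length-elements (inside ∷ p) = cong suc (trans (length-map suc (elements p)) (length-elements p))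
length-elements (outside ∷ p) = trans (length-map suc (elements p)) (length-elements p)

elements-sound : (p : Subset m) → All (_∈ p) (elements p)
elements-sound [] = []
elements-sound (inside ∷ p) = here ∷ All.map⁺ (All.map there (elements-sound p))
elements-sound (outside ∷ p) = All.map⁺ (All.map there (elements-sound p))

∈-elements : ∀ {x : Fin m} {p} → x ∈ p → x List.∈ elements p
∈-elements {p = inside ∷ p} here = here refl
∈-elements {p = inside ∷ p} (there x∈p) = there (∈-map⁺ suc (∈-elements x∈p))
∈-elements {p = outside ∷ p} (there x∈p) = ∈-map⁺ suc (∈-elements x∈p)

module Greedy {a r} {A : Set a} {R : A → A → Set r} (R? : Decidable R) where

  greedy : List A → List A → List A
  greedy chosen [] = chosen
  greedy chosen (x ∷ xs) with all? (R? x) chosen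
  ... | yes _ = greedy (x ∷ chosen) xs
  ... | no _ = greedy chosen xs

  greedy-All : ∀ {p} {P : A → Set p} chosen xs → All P chosen → All P xs → All P (greedy chosen xs)
  greedy-All chosen [] Pchosen [] = Pchosen
  greedy-All chosen (x ∷ xs) Pchosen (Px ∷ Pxs) with all? (R? x) chosen
  ... | yes _ = greedy-All (x ∷ chosen) xs (Px ∷ Pchosen) Pxs
  ... | no _ = greedy-All chosen xs Pchosen Pxs

  greedy-pairwise : ∀ chosen xs → AllPairs R chosen → AllPairs R (greedy chosen xs)
  greedy-pairwise chosen [] pairwise = pairwise
  greedy-pairwise chosen (x ∷ xs) pairwise with all? (R? x) chosen
  ... | yes x-fits = greedy-pairwise (x ∷ chosen) xs (x-fits ∷ pairwise)
  ... | no _ = greedy-pairwise chosen xs pairwise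

  chosen⊆greedy : ∀ chosen xs → chosen List.⊆ greedy chosen xs
  chosen⊆greedy chosen [] = λ y∈ → y∈
  chosen⊆greedy chosen (x ∷ xs) with all? (R? x) chosen
  ... | yes _ = chosen⊆greedy (x ∷ chosen) xs ∘ there
  ... | no _ = chosen⊆greedy chosen xs

  greedy-maximal : ∀ chosen xs {x} → x List.∈ xs → ¬ R x x → Any (¬_ ∘ R x) (greedy chosen xs)
  greedy-maximal chosen (x ∷ xs) (here refl) ¬Rxx with all? (R? x) chosen
  ... | yes _ = lose (chosen⊆greedy (x ∷ chosen) xs (here refl)) ¬Rxx
  ... | no x-conflicts = Any-resp-⊆ (chosen⊆greedy chosen xs) (¬All⇒Any¬ (R? x) chosen x-conflicts)
  greedy-maximal chosen (y ∷ xs) (there x∈xs) ¬Rxx with all? (R? y) chosen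
  ... | yes _ = greedy-maximal (y ∷ chosen) xs x∈xs ¬Rxx
  ... | no _ = greedy-maximal chosen xs x∈xs ¬Rxx

Disjoint : Subset m → Subset m → Set
Disjoint p q = Empty (p ∩ q)

disjoint? : Decidable (Disjoint {m})
disjoint? p q = ¬? (nonempty? (p ∩ q))

Nonempty⇒¬Disjoint-self : {p : Subset m} → Nonempty p → ¬ Disjoint p p
Nonempty⇒¬Disjoint-self (x , x∈p) p∩p-empty = p∩p-empty (x , x∈p∩q⁺ (x∈p , x∈p))

disjoint⇒unique : {ps : List (Subset m)} → All Nonempty ps → AllPairs Disjoint ps → Unique ps
disjoint⇒unique [] [] = []
disjoint⇒unique {ps = p ∷ _} (p≠∅ ∷ ps≠∅) (p#ps ∷ disjoint) =
  All.map (λ p#q p≡q → Nonempty⇒¬Disjoint-self p≠∅ (subst (Disjoint p) (sym p≡q) p#q)) p#ps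
    ∷ disjoint⇒unique ps≠∅ disjoint

Uniform : ∀ {n} → ℕ → Hypergraph n → Set
Uniform r H = All (λ e → ∣ e ∣ ≡ r) (edges H)

uniform⇒edges-nonempty : ∀ {n d} {H : Hypergraph n} → Uniform (suc d) H → All Nonempty (edges H)
uniform⇒edges-nonempty = All.map (∣p∣≡1+k⇒Nonempty _)

module _ {n} (H : Hypergraph n) where

  incident : Fin n → List (Subset n)
  incident x = filter (x ∈?_) (edges H)

  star : Fin n → Subset n
  star x = ⁅ x ⁆ ∪⋃ incident x

  neighbourhood : Subset n → Subset n
  neighbourhood e = e ∪⋃ map star (elements e)

  edge⊆star : ∀ {e x} → e List.∈ edges H → x ∈ e → e ⊆ star x
  edge⊆star e∈H x∈e = q∈qs⇒q⊆p∪⋃qs (∈-filter⁺ (_ ∈?_) e∈H x∈e)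

  star⊆neighbourhood : ∀ {e x} → x ∈ e → star x ⊆ neighbourhood e
  star⊆neighbourhood x∈e = q∈qs⇒q⊆p∪⋃qs (∈-map⁺ star (∈-elements x∈e))

  meeting-edge⊆neighbourhood : ∀ {e f} → f List.∈ edges H → Nonempty (f ∩ e) → f ⊆ neighbourhood e
  meeting-edge⊆neighbourhood {e} {f} f∈H (x , x∈f∩e) =
    star⊆neighbourhood (proj₂ (x∈p∩q⁻ f e x∈f∩e)) ∘ edge⊆star f∈H (proj₁ (x∈p∩q⁻ f e x∈f∩e))

  ∣star∣≤1+degree*d : ∀ {d} → Uniform (suc d) H → ∀ x → ∣ star x ∣ ≤ 1 + degree H x * d
  ∣star∣≤1+degree*d {d} uniform x = subst (λ k → ∣ star x ∣ ≤ k + degree H x * d) (∣⁅x⁆∣≡1 x)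
    (∣p∪⋃qs∣≤∣p∣+∣qs∣*d ⁅ x ⁆ d (incident x)
      (All.zipWith (Product.uncurry extends) (all-filter (x ∈?_) (edges H) , filter⁺ (x ∈?_) uniform)))
    where
    extends : ∀ {f} → x ∈ f → ∣ f ∣ ≡ suc d → ⁅ x ⁆ ⊆ f × ∣ f ∣ ≤ ∣ ⁅ x ⁆ ∣ + d
    extends x∈f ∣f∣≡1+d = x∈p⇒⁅x⁆⊆p x∈f , ≤-reflexive (trans ∣f∣≡1+d (cong (_+ d) (sym (∣⁅x⁆∣≡1 x))))

  ∣neighbourhood∣≤ : ∀ {d δ e} → Uniform (suc d) H → (∀ x → degree H x ≤ suc δ) → e List.∈ edges H →
    ∣ neighbourhood e ∣ ≤ suc d * suc (δ * d)
  ∣neighbourhood∣≤ {d} {δ} {e} uniform degree≤ e∈H = begin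
    ∣ neighbourhood e ∣                              ≤⟨ ∣p∪⋃qs∣≤∣p∣+∣qs∣*d e (δ * d) stars stars-extend ⟩
    ∣ e ∣ + length stars * (δ * d)                   ≡⟨ cong₂ (λ k l → k + l * (δ * d)) ∣e∣≡1+d length-stars ⟩
    suc d + suc d * (δ * d)                          ≡⟨ *-suc (suc d) (δ * d) ⟨
    suc d * suc (δ * d)                              ∎
    where
    open ≤-Reasoning
    ∣e∣≡1+d = All.lookup uniform e∈H
    stars = map star (elements e)
    length-stars : length stars ≡ suc d
    length-stars = trans (length-map star (elements e)) (trans (length-elements e) ∣e∣≡1+d)
    star-extends : ∀ {x} → x ∈ e → e ⊆ star x × ∣ star x ∣ ≤ ∣ e ∣ + δ * d
    star-extends {x} x∈e = edge⊆star e∈H x∈e , subst (λ k → ∣ star x ∣ ≤ k + δ * d) (sym ∣e∣≡1+d)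
      (≤-trans (∣star∣≤1+degree*d uniform x) (+-monoʳ-≤ 1 (*-monoˡ-≤ d (degree≤ x))))
    stars-extend : All (λ q → e ⊆ q × ∣ q ∣ ≤ ∣ e ∣ + δ * d) stars
    stars-extend = All.map⁺ (All.map star-extends (elements-sound e))

  open Greedy (disjoint? {n})

  greedyMatching : List (Subset n)
  greedyMatching = greedy [] (edges H)

  greedyMatching⊆edges : All (List._∈ edges H) greedyMatching
  greedyMatching⊆edges = greedy-All [] (edges H) [] (All.tabulate id)

  greedyMatching-isMatching : All Nonempty (edges H) → IsMatching H greedyMatching
  greedyMatching-isMatching edges≠∅ =
    disjoint⇒unique (greedy-All [] (edges H) [] edges≠∅) (greedy-pairwise [] (edges H) []) ,
    greedyMatching⊆edges ,
    greedy-pairwise [] (edges H) []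

  greedyMatching-maximal : ∀ {f} → f List.∈ edges H → Nonempty f → Any (λ e → Nonempty (f ∩ e)) greedyMatching
  greedyMatching-maximal f∈H f≠∅ =
    Any.map (decidable-stable (nonempty? _)) (greedy-maximal [] (edges H) f∈H (Nonempty⇒¬Disjoint-self f≠∅))

greedyMatching-neighbourhoods-cover : ∀ {n d} (H : Hypergraph n) → Uniform (suc d) H →
  (∀ v → 1 ≤ degree H v) → ⊤ ⊆ ⋃ (map (neighbourhood H) (greedyMatching H))
greedyMatching-neighbourhoods-cover H uniform 1≤degree {v} _
  with f , f∈incident ← 1≤length⇒∃∈ (incident H v) (1≤degree v)
  with f∈H , v∈f ← ∈-filter⁻ (v ∈?_) {xs = edges H} f∈incident
  with e , e∈M , f∩e≠∅ ← find (greedyMatching-maximal H f∈H (∣p∣≡1+k⇒Nonempty f (All.lookup uniform f∈H)))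
  = q∈qs⇒q⊆p∪⋃qs (∈-map⁺ (neighbourhood H) e∈M) (meeting-edge⊆neighbourhood H f∈H f∩e≠∅ v∈f)

greedyMatching-large : ∀ {n d δ} (H : Hypergraph n) → Uniform (suc d) H →
  (∀ v → 1 ≤ degree H v × degree H v ≤ suc δ) →
  Σ (List (Subset n)) (λ M → IsMatching H M × n ≤ suc d * suc (δ * d) * length M)
greedyMatching-large {n} {d} {δ} H uniform degree-bounds =
  M , greedyMatching-isMatching H (uniform⇒edges-nonempty {H = H} uniform) , (begin
    n                                   ≡⟨ ∣⊤∣≡n n ⟨
    ∣ ⊤ {n} ∣                           ≤⟨ p⊆q⇒∣p∣≤∣q∣ (greedyMatching-neighbourhoods-cover H uniform (proj₁ ∘ degree-bounds)) ⟩
    ∣ ⋃ (map (neighbourhood H) M) ∣     ≤⟨ ∣⋃qs∣≤∣qs∣*d bound _ (All.map⁺ (All.map ∣neighbourhood∣≤bound (greedyMatching⊆edges H))) ⟩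
    length (map (neighbourhood H) M) * bound ≡⟨ cong (_* bound) (length-map (neighbourhood H) M) ⟩
    length M * bound                    ≡⟨ *-comm (length M) bound ⟩
    bound * length M                    ∎)
  where
  open ≤-Reasoning
  M = greedyMatching H
  bound = suc d * suc (δ * d)
  ∣neighbourhood∣≤bound : ∀ {e} → e List.∈ edges H → ∣ neighbourhood H e ∣ ≤ bound
  ∣neighbourhood∣≤bound = ∣neighbourhood∣≤ H {δ = δ} uniform (proj₂ ∘ degree-bounds)

mainTheorem18 : (n : ℕ) (H : Hypergraph n) → ThreeUniform H →
    ((v : Fin n) → (1 ≤ degree H v) × (degree H v ≤ 2)) →
    Σ (List (Subset n)) (λ M → IsMatching H M × (n ≤ 9 * length M))
mainTheorem18 n H uniform degree-bounds = greedyMatching-large {d = 2} {δ = 1} H uniform degree-bounds
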